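{- Let $G$ be a finite non-abelian nilpotent group. Then there is no graph $\Gamma$ such that $\mathcal{P}(G)=L(\Gamma)$.
   Context: For a finite group $G$, the power graph $\mathcal{P}(G)$ is the simple graph with vertex set $G$ in which two distinct vertices $u,v$ are adjacent iff $u^m=v$ or $v^n=u$ for some positive integers $m,n$. $L(\Gamma)$ denotes the line graph of $\Gamma$: its vertices are the edges of $\Gamma$, two adjacent iff they share an endpoint. -}

module Defs where

open import Data.Nat using (ℕ; zero; suc)
open import Data.Fin using (Fin; _<_)
open import Data.Bool using (Bool; T; false)
open import Data.Product using (Σ; ∃; _×_; _,_; proj₁)
open import Data.Sum using (_⊎_)
open import Relation.Nullary using (¬_)
open import Relation.Binary.PropositionalEquality using (_≡_; _≢_)
open import Function.Bundles using (_↔_; Inverse; _⇔_)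
open import Algebra.Core using (Op₁; Op₂)
open import Algebra.Structures using (IsGroup)

record Graph : Set₁ where
  field
    V   : Set
    Adj : V → V → Set

record _≅_ (Γ Δ : Graph) : Set where
  field
    bij : Graph.V Γ ↔ Graph.V Δ
    adj : ∀ u v → Graph.Adj Γ u v ⇔ Graph.Adj Δ (Inverse.to bij u) (Inverse.to bij v)

module _ {n : ℕ} (_∙_ : Op₂ (Fin n)) (ε : Fin n) (_⁻¹ : Op₁ (Fin n)) where

  pow : Fin n → ℕ → Fin n
  pow x zero    = ε
  pow x (suc k) = x ∙ pow x k

  comm : Fin n → Fin n → Fin n
  comm x y = ((x ⁻¹) ∙ (y ⁻¹)) ∙ (x ∙ y)

  -- upper central series: Z 0 = {e}, Z (i+1) = {x | ∀ g, [x,g] ∈ Z i}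
  -- (i.e. Z (i+1) / Z i = Z (G / Z i))
  UpperCentral : ℕ → Fin n → Set
  UpperCentral zero    x = x ≡ ε
  UpperCentral (suc i) x = ∀ g → UpperCentral i (comm x g)

  Nilpotent : Set
  Nilpotent = ∃ λ c → ∀ x → UpperCentral c x

  NonAbelian : Set
  NonAbelian = ¬ (∀ x y → (x ∙ y) ≡ (y ∙ x))

  PowerGraph : Graph
  PowerGraph = record
    { V   = Fin n
    ; Adj = λ u v → u ≢ v × ((∃ λ m → pow u (suc m) ≡ v) ⊎ (∃ λ m → pow v (suc m) ≡ u)) }

record SimpleGraph (m : ℕ) : Set where
  field
    adj   : Fin m → Fin m → Bool
    sym   : ∀ i j → adj i j ≡ adj j i
    irrefl : ∀ i → adj i i ≡ false

-- an edge {i , j} is represented uniquely by i < j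
Edge : ∀ {m} → SimpleGraph m → Set
Edge {m} Γ = Σ (Fin m) λ i → Σ (Fin m) λ j → i < j × T (SimpleGraph.adj Γ i j)

endpoints : ∀ {m} {Γ : SimpleGraph m} → Edge Γ → Fin m × Fin m
endpoints (i , j , _) = i , j

LineGraph : ∀ {m} → SimpleGraph m → Graph
LineGraph {m} Γ = record
  { V   = Edge Γ
  ; Adj = λ e f → endpoints {Γ = Γ} e ≢ endpoints {Γ = Γ} f × Share e f }
  where
  Share : Edge Γ → Edge Γ → Set
  Share (i , j , _) (k , l , _) = (i ≡ k) ⊎ (i ≡ l) ⊎ (j ≡ k) ⊎ (j ≡ l)

-- Every element of a finite group has finite order, so the identity is adjacent in the
-- power graph to every other element, while adjacent elements commute, one being a power
-- of the other.  Hence for non-commuting x and y the identity together with x, y and xy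
-- spans an induced claw K₁,₃.  Line graphs are claw-free: three edges meeting an edge e
-- each contain one of the two endpoints of e, so two of them contain the same one.
module Submission where

open import Defs
open import Level using (0ℓ)
open import Data.Nat using (ℕ; zero; suc; _+_)
import Data.Nat.Properties as ℕ
open import Data.Fin using (Fin; zero; suc; toℕ)
open import Data.Fin.Properties using (pigeonhole; <⇒≢; <-irrelevant; ¬∀⟶∃¬; all?; _≟_)
open import Data.Bool.Properties using (T-irrelevant)
open import Data.Product using (∃; ∃₂; _,_; proj₁; proj₂)
open import Data.Sum using (inj₁; inj₂)
open import Data.Empty using (⊥-elim)
open import Function using (_∘_)
open import Function.Bundles using (Inverse; Injection; Equivalence)
open import Function.Properties.Inverse using (↔⇒↣)
open import Relation.Nullary using (¬_)
open import Relation.Binary.PropositionalEquality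
  using (_≡_; _≢_; refl; sym; trans; cong; subst; module ≡-Reasoning)
open import Algebra.Core using (Op₁; Op₂)
open import Algebra.Bundles using (Group)
open import Algebra.Structures using (IsGroup)
import Algebra.Properties.Group as GroupProperties

record Claw (Γ : Graph) : Set where
  open Graph Γ
  field
    centre             : V
    leaf               : Fin 3 → V
    spoke              : ∀ i → Adj centre (leaf i)
    leaf-injective     : ∀ {i j} → i ≢ j → leaf i ≢ leaf j
    leaves-nonadjacent : ∀ {i j} → i ≢ j → ¬ Adj (leaf i) (leaf j)

claw-≅ : ∀ {Γ Δ} → Γ ≅ Δ → Claw Γ → Claw Δ
claw-≅ iso κ = record
  { centre             = to centre
  ; leaf               = to ∘ leaf
  ; spoke              = λ i → Equivalence.to (adj centre (leaf i)) (spoke i)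
  ; leaf-injective     = λ i≢j → leaf-injective i≢j ∘ injective
  ; leaves-nonadjacent = λ i≢j → leaves-nonadjacent i≢j ∘ Equivalence.from (adj _ _)
  }
  where
  open _≅_ iso
  open Inverse bij using (to)
  open Injection (↔⇒↣ bij) using (injective)
  open Claw κ

module _ {m : ℕ} (Γ : SimpleGraph m) where

  open Graph (LineGraph Γ) using (Adj)

  endpoint : Edge Γ → Fin 2 → Fin m
  endpoint (i , j , _) zero       = i
  endpoint (i , j , _) (suc zero) = j

  _∋_ : Edge Γ → Fin m → Set
  e ∋ a = ∃ λ k → endpoint e k ≡ a

  endpoints-injective : ∀ e f → endpoints {Γ = Γ} e ≡ endpoints {Γ = Γ} f → e ≡ f
  endpoints-injective (i , j , i<j , ij) (.i , .j , i<j′ , ij′) refl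
    rewrite <-irrelevant i<j i<j′ | T-irrelevant ij ij′ = refl

  adjacent⇒∋-endpoint : ∀ e f → Adj e f → ∃ λ k → f ∋ endpoint e k
  adjacent⇒∋-endpoint (i , j , _) (k , l , _) (_ , inj₁ i≡k)               = zero , zero , sym i≡k
  adjacent⇒∋-endpoint (i , j , _) (k , l , _) (_ , inj₂ (inj₁ i≡l))        = zero , suc zero , sym i≡l
  adjacent⇒∋-endpoint (i , j , _) (k , l , _) (_ , inj₂ (inj₂ (inj₁ j≡k))) = suc zero , zero , sym j≡k
  adjacent⇒∋-endpoint (i , j , _) (k , l , _) (_ , inj₂ (inj₂ (inj₂ j≡l))) = suc zero , suc zero , sym j≡l

  common-endpoint⇒adjacent : ∀ e f {a} → e ≢ f → e ∋ a → f ∋ a → Adj e f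
  common-endpoint⇒adjacent e@(i , j , _) f@(k , l , _) e≢f (p , ep≡a) (q , fq≡a) =
    e≢f ∘ endpoints-injective e f , share p q ep≡a fq≡a
    where
    share : ∀ p q → endpoint e p ≡ _ → endpoint f q ≡ _ → _
    share zero       zero       x y = inj₁ (trans x (sym y))
    share zero       (suc zero) x y = inj₂ (inj₁ (trans x (sym y)))
    share (suc zero) zero       x y = inj₂ (inj₂ (inj₁ (trans x (sym y))))
    share (suc zero) (suc zero) x y = inj₂ (inj₂ (inj₂ (trans x (sym y))))

  lineGraph-clawFree : ¬ Claw (LineGraph Γ)
  lineGraph-clawFree κ =
    let i , j , i<j , same-side = pigeonhole (ℕ.n<1+n 2) (proj₁ ∘ meets)
        i≢j = <⇒≢ i<j
    in leaves-nonadjacent i≢j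
         (common-endpoint⇒adjacent (leaf i) (leaf j) (leaf-injective i≢j) (proj₂ (meets i))
           (subst (λ k → leaf j ∋ endpoint centre k) (sym same-side) (proj₂ (meets j))))
    where
    open Claw κ
    meets : ∀ i → ∃ λ k → leaf i ∋ endpoint centre k
    meets i = adjacent⇒∋-endpoint centre (leaf i) (spoke i)

module _ {n : ℕ} (_∙_ : Op₂ (Fin n)) (ε : Fin n) (_⁻¹ : Op₁ (Fin n))
         (isGroup : IsGroup _≡_ _∙_ ε _⁻¹) where

  open IsGroup isGroup using (assoc; identityˡ; identityʳ)
  private
    group : Group 0ℓ 0ℓ
    group = record { isGroup = isGroup }

  open GroupProperties group using (∙-cancelˡ; ∙-cancelʳ)
  open Graph (PowerGraph _∙_ ε _⁻¹) using (Adj)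
  open ≡-Reasoning

  private
    _^_ : Fin n → ℕ → Fin n
    _^_ = pow _∙_ ε _⁻¹

  Commute : Fin n → Fin n → Set
  Commute a b = a ∙ b ≡ b ∙ a

  ¬commute-sym : ∀ {a b} → ¬ Commute a b → ¬ Commute b a
  ¬commute-sym ¬ab = ¬ab ∘ sym

  ¬commute⇒≢ : ∀ {a b} → ¬ Commute a b → a ≢ b
  ¬commute⇒≢ ¬ab refl = ¬ab refl

  ¬commute⇒≢ε : ∀ {a b} → ¬ Commute a b → a ≢ ε
  ¬commute⇒≢ε {b = b} ¬ab refl = ¬ab (trans (identityˡ b) (sym (identityʳ b)))

  ¬commute-∙ʳ : ∀ {x y} → ¬ Commute x y → ¬ Commute x (x ∙ y)
  ¬commute-∙ʳ {x} {y} ¬xy x[xy]≡[xy]x = ¬xy (∙-cancelˡ x _ _ (trans x[xy]≡[xy]x (assoc x y x)))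

  ¬commute-∙ˡ : ∀ {x y} → ¬ Commute x y → ¬ Commute y (x ∙ y)
  ¬commute-∙ˡ {x} {y} ¬xy y[xy]≡[xy]y = ¬xy (sym (∙-cancelʳ y _ _ (trans (assoc y x y) y[xy]≡[xy]y)))

  ^-commute : ∀ x k → Commute (x ^ k) x
  ^-commute x zero    = trans (identityˡ x) (sym (identityʳ x))
  ^-commute x (suc k) = trans (assoc x (x ^ k) x) (cong (x ∙_) (^-commute x k))

  ^-homo-+ : ∀ x k l → x ^ (k + l) ≡ (x ^ k) ∙ (x ^ l)
  ^-homo-+ x zero    l = sym (identityˡ _)
  ^-homo-+ x (suc k) l = trans (cong (x ∙_) (^-homo-+ x k l)) (sym (assoc x (x ^ k) (x ^ l)))

  -- Two of x ^ 0, …, x ^ n coincide, say x ^ i = x ^ (i + suc d); cancel x ^ i.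
  finite-order : ∀ x → ∃ λ d → x ^ suc d ≡ ε
  finite-order x =
    let i , j , i<j , xⁱ≡xʲ = pigeonhole (ℕ.n<1+n n) (λ i → x ^ toℕ i)
        d , i+1+d≡j = ℕ.m≤n⇒∃[o]m+o≡n i<j
        i+[1+d]≡j = trans (ℕ.+-suc (toℕ i) d) i+1+d≡j
    in d , ∙-cancelˡ (x ^ toℕ i) _ _ (begin
      (x ^ toℕ i) ∙ (x ^ suc d)  ≡⟨ ^-homo-+ x (toℕ i) (suc d) ⟨
      x ^ (toℕ i + suc d)        ≡⟨ cong (x ^_) i+[1+d]≡j ⟩
      x ^ toℕ j                  ≡⟨ xⁱ≡xʲ ⟨
      x ^ toℕ i                  ≡⟨ identityʳ _ ⟨
      (x ^ toℕ i) ∙ ε            ∎)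

  ε-adjacent : ∀ {u} → u ≢ ε → Adj ε u
  ε-adjacent u≢ε = u≢ε ∘ sym , inj₂ (finite-order _)

  adjacent⇒commute : ∀ {u v} → Adj u v → Commute u v
  adjacent⇒commute (_ , inj₁ (k , refl)) = sym (^-commute _ (suc k))
  adjacent⇒commute (_ , inj₂ (k , refl)) = ^-commute _ (suc k)

  noncommuting-pair : NonAbelian _∙_ ε _⁻¹ → ∃₂ λ x y → ¬ Commute x y
  noncommuting-pair nonAbelian =
    let x , ¬central = ¬∀⟶∃¬ n (λ x → ∀ y → Commute x y) (λ x → all? (λ y → x ∙ y ≟ y ∙ x)) nonAbelian
        y , ¬xy      = ¬∀⟶∃¬ n (Commute x) (λ y → x ∙ y ≟ y ∙ x) ¬central
    in x , y , ¬xy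

  nonAbelian⇒claw : NonAbelian _∙_ ε _⁻¹ → Claw (PowerGraph _∙_ ε _⁻¹)
  nonAbelian⇒claw nonAbelian = record
    { centre             = ε
    ; leaf               = leaf
    ; spoke              = spoke
    ; leaf-injective     = ¬commute⇒≢ ∘ leaves-noncommuting
    ; leaves-nonadjacent = λ i≢j → leaves-noncommuting i≢j ∘ adjacent⇒commute
    }
    where
    x = proj₁ (noncommuting-pair nonAbelian)
    y = proj₁ (proj₂ (noncommuting-pair nonAbelian))
    ¬xy : ¬ Commute x y
    ¬xy = proj₂ (proj₂ (noncommuting-pair nonAbelian))

    leaf : Fin 3 → Fin n
    leaf zero             = x
    leaf (suc zero)       = y
    leaf (suc (suc zero)) = x ∙ y

    leaves-noncommuting : ∀ {i j} → i ≢ j → ¬ Commute (leaf i) (leaf j)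
    leaves-noncommuting {zero}             {suc zero}       _ = ¬xy
    leaves-noncommuting {zero}             {suc (suc zero)} _ = ¬commute-∙ʳ ¬xy
    leaves-noncommuting {suc zero}         {zero}           _ = ¬commute-sym ¬xy
    leaves-noncommuting {suc zero}         {suc (suc zero)} _ = ¬commute-∙ˡ ¬xy
    leaves-noncommuting {suc (suc zero)}   {zero}           _ = ¬commute-sym (¬commute-∙ʳ ¬xy)
    leaves-noncommuting {suc (suc zero)}   {suc zero}       _ = ¬commute-sym (¬commute-∙ˡ ¬xy)
    leaves-noncommuting {zero}             {zero}           i≢i = ⊥-elim (i≢i refl)
    leaves-noncommuting {suc zero}         {suc zero}       i≢i = ⊥-elim (i≢i refl)
    leaves-noncommuting {suc (suc zero)}   {suc (suc zero)} i≢i = ⊥-elim (i≢i refl)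

    spoke : ∀ i → Adj ε (leaf i)
    spoke zero    = ε-adjacent (¬commute⇒≢ε (leaves-noncommuting {zero} {suc zero} λ ()))
    spoke (suc i) = ε-adjacent (¬commute⇒≢ε (leaves-noncommuting {suc i} {zero} λ ()))

mainTheorem9 : ∀ {n : ℕ} (_∙_ : Op₂ (Fin n)) (ε : Fin n) (_⁻¹ : Op₁ (Fin n))
               → IsGroup _≡_ _∙_ ε _⁻¹
               → Nilpotent _∙_ ε _⁻¹
               → NonAbelian _∙_ ε _⁻¹
               → ∀ {m : ℕ} (Γ : SimpleGraph m)
               → ¬ (PowerGraph _∙_ ε _⁻¹ ≅ LineGraph Γ)
mainTheorem9 _∙_ ε _⁻¹ isGroup _ nonAbelian Γ P≅L =
  lineGraph-clawFree Γ (claw-≅ P≅L (nonAbelian⇒claw _∙_ ε _⁻¹ isGroup nonAbelian))
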